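{- Let $k>1$ and $n$ be positive integers. If $n\ge 2k-1$, then intersecting codes are dense among $[n,k]_q$ codes as $q\to\infty$, i.e. the proportion of $k$-dimensional subspaces of $\mathbb F_q^n$ that are intersecting codes tends to $1$ as $q\to\infty$ over prime powers. If $n<2k-1$, then intersecting codes are sparse among $[n,k]_q$ codes as $q\to\infty$, i.e. this proportion tends to $0$.
   Context: An $[n,k]_q$ code is a $k$-dimensional $\mathbb F_q$-linear subspace of $\mathbb F_q^n$. For $x\in\mathbb F_q^n$, the Hamming support is $\sigma(x)=\{i: x_i\neq0\}$. A code $\mathscr C$ is intersecting if $\sigma(v)\cap\sigma(w)\neq\emptyset$ for all nonzero $v,w\in\mathscr C$. -}

module Defs where

open import Data.Nat using (ℕ; zero; suc; _+_; _*_; _∸_; _≤_; _<_)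
open import Data.Fin using (Fin; zero; suc)
open import Data.Vec using (Vec; []; _∷_; lookup; zipWith; map; replicate)
open import Data.Bool using (Bool; true)
open import Data.Product using (Σ; ∃; _×_; _,_)
open import Relation.Binary.PropositionalEquality using (_≡_; _≢_)
open import Algebra.Structures using (IsCommutativeRing)
open import Function.Bundles using (_↔_)

-- Its size q is then automatically a prime power,
-- and every prime power occurs (uniquely up to isomorphism).
record FiniteField : Set₁ where
  infixl 6 _+F_
  infixl 7 _*F_
  field
    Carrier : Set
    _+F_ _*F_ : Carrier → Carrier → Carrier
    -F_ : Carrier → Carrier
    0F 1F : Carrier
    isCommutativeRing : IsCommutativeRing _≡_ _+F_ _*F_ -F_ 0F 1F
    0≢1 : 0F ≢ 1F
    inverse : ∀ x → x ≢ 0F → ∃ λ y → x *F y ≡ 1F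
    size : ℕ
    enum : Carrier ↔ Fin size

module _ (F : FiniteField) where
  open FiniteField F

  Vect : ℕ → Set
  Vect n = Vec Carrier n

  zeroV : ∀ {n} → Vect n
  zeroV = replicate _ 0F

  lincomb : ∀ {n} k → (Fin k → Carrier) → (Fin k → Vect n) → Vect n
  lincomb zero c v = zeroV
  lincomb (suc k) c v =
    zipWith _+F_ (map (c zero *F_) (v zero)) (lincomb k (λ i → c (suc i)) (λ i → v (suc i)))

  LinIndep : ∀ {n} k → (Fin k → Vect n) → Set
  LinIndep k v = ∀ c → lincomb k c v ≡ zeroV → ∀ i → c i ≡ 0F

  SubsetV : ℕ → Set
  SubsetV n = Vect n → Bool

  IsSubspaceOfDim : ∀ n k → SubsetV n → Set
  IsSubspaceOfDim n k S =
    Σ (Fin k → Vect n) λ v → LinIndep k v ×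
      (∀ x → (S x ≡ true → ∃ λ c → x ≡ lincomb k c v) × (∃ (λ c → x ≡ lincomb k c v) → S x ≡ true))

  NonZeroV : ∀ {n} → Vect n → Set
  NonZeroV x = x ≢ zeroV

  SupportsMeet : ∀ {n} → Vect n → Vect n → Set
  SupportsMeet {n} x y = ∃ λ (i : Fin n) → (lookup x i ≢ 0F) × (lookup y i ≢ 0F)

  IsIntersecting : ∀ n → SubsetV n → Set
  IsIntersecting n S = ∀ x y → S x ≡ true → S y ≡ true → NonZeroV x → NonZeroV y → SupportsMeet x y

  IsCode : ∀ n k → SubsetV n → Set
  IsCode n k S = IsSubspaceOfDim n k S

  IsIntersectingCode : ∀ n k → SubsetV n → Set
  IsIntersectingCode n k S = IsSubspaceOfDim n k S × IsIntersecting n S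

  -- N is the number of subsets (up to extensional equality, i.e. as sets)
  -- satisfying P: a list of N pairwise distinct such subsets exhausting all of them.
  ExtEq : ∀ {n} → SubsetV n → SubsetV n → Set
  ExtEq S T = ∀ x → S x ≡ T x

  IsCount : ∀ n → (SubsetV n → Set) → ℕ → Set
  IsCount n P N =
    Σ (Fin N → SubsetV n) λ L →
      (∀ i → P (L i)) ×
      (∀ i j → ExtEq (L i) (L j) → i ≡ j) ×
      (∀ S → P S → ∃ λ i → ExtEq S (L i))

-- proportion M/N tends to 1 as q → ∞ : for every m there is Q such that for
-- every finite field of size ≥ Q, (N - M)/N ≤ 1/(m+1).
DenseIntersecting : ℕ → ℕ → Set₁
DenseIntersecting n k =
  ∀ (m : ℕ) → ∃ λ (Q : ℕ) → ∀ (F : FiniteField) → Q ≤ FiniteField.size F →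
    ∀ N M → IsCount F n (IsCode F n k) N → IsCount F n (IsIntersectingCode F n k) M →
      suc m * (N ∸ M) ≤ N

-- proportion M/N tends to 0 as q → ∞ : M/N ≤ 1/(m+1) eventually.
SparseIntersecting : ℕ → ℕ → Set₁
SparseIntersecting n k =
  ∀ (m : ℕ) → ∃ λ (Q : ℕ) → ∀ (F : FiniteField) → Q ≤ FiniteField.size F →
    ∀ N M → IsCount F n (IsCode F n k) N → IsCount F n (IsIntersectingCode F n k) M →
      suc m * M ≤ N

{-# OPTIONS --safe #-}
module Submission where

-- Represent an [n,k] code by a k × n generator matrix M, and call M degenerate when some nonzero
-- codeword vanishes on k coordinates (M has a singular k × k minor).
--
-- If n ≥ 2k − 1, two nonzero codewords with disjoint supports have at least n ≥ 2k − 1 zeros between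
-- them, so one of them has k zeros: a code with a nondegenerate generator matrix is intersecting.
-- Nondegenerate matrices have full rank and every code has exactly |GL_k| generator matrices, so it
-- suffices that degenerate matrices are rare. Given the k vanishing columns t, a pivot row i, the
-- rescaled relation u c and M with its entries (i, t j) overwritten arbitrarily, the relation recovers
-- those entries; hence #degenerate · (q − 1) · q^k ≤ n^k · k · q^k · q^(nk), and at most a fraction
-- O(k n^k / q) of the codes is not intersecting.
--
-- If n ≤ 2k − 2, split the coordinates into two blocks of fewer than k positions; by pigeonhole some
-- nonzero codeword vanishes on each block, and these two codewords have disjoint supports.

open import Defs
open import Algebra.Bundles using (CommutativeRing)
import Algebra.Properties.Ring as RingProperties
open import Data.Bool using (true)
open import Data.Bool.Properties using (⇔→≡)
open import Data.Fin as Fin using (Fin; zero; suc; punchIn; inject≤; _↑ˡ_; _↑ʳ_; splitAt)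
open import Data.Fin.Properties
  using (injective⇒≤; pigeonhole; *↔×; +↔⊎; 1↔⊤; any?; all?; <⇒≢; punchInᵢ≢i; inject≤-injective; suc-injective; 0≢1+n;
         splitAt⁻¹-↑ˡ; splitAt⁻¹-↑ʳ)
  renaming (_≟_ to _≟ᶠ_)
open import Data.Irrelevant using ([_])
open import Data.Nat using (ℕ; zero; suc; _+_; _*_; _∸_; _^_; _≤_; _<_; _≤?_; z≤n; s≤s; NonZero; >-nonZero)
open import Data.Nat.Properties
  using (≤-refl; ≤-reflexive; ≤-trans; <-irrefl; <⇒≤; ≰⇒>; ≤-pred; m≤m+n; +-mono-≤; +-cancelˡ-≤;
         *-zeroʳ; *-monoʳ-≤; *-monoˡ-≤; *-cancelʳ-≤; *-cancelˡ-≤; *-distribˡ-∸; m*n≢0; m^n≢0; ^-monoʳ-<;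
         m+n≤o⇒m≤o∸n; m≤n+o⇒m∸n≤o; m+[n∸m]≡n)
import Data.Nat.Properties as ℕ
open import Data.Nat.Tactic.RingSolver using (solve-∀)
open import Data.Product using (∃; ∃₂; _×_; _,_; proj₁; proj₂; uncurry)
open import Data.Product.Function.NonDependent.Propositional using (_×-↔_)
open import Data.Product.Properties using (,-injective; ,-injectiveˡ; ,-injectiveʳ)
open import Data.Refinement using (Refinement-syntax; _,_; value)
import Data.Refinement as Refinement
open import Data.Refinement.Properties using (value-injective)
open import Data.Sum using (_⊎_; inj₁; inj₂)
open import Data.Sum.Function.Propositional using (_⊎-↔_)
open import Data.Sum.Properties using (inj₁-injective; inj₂-injective)
open import Data.Unit using (tt)
open import Data.Vec using (Vec; []; _∷_; lookup; tabulate; map; zipWith; _[_]≔_; _[_]%=_)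
open import Data.Vec.Properties
  using (≡-dec; lookup∘tabulate; tabulate∘lookup; tabulate-cong; lookup-map; lookup-zipWith; lookup-replicate;
         lookup∘update; lookup∘update′; lookup∘updateAt; lookup∘updateAt′; map-∘; map-cong)
open import Function using (_∘_; id; Injective; Inverse; Injection; Equivalence; _↔_; _↣_; _⇔_; mk↔ₛ′; mk↣; mk⇔)
open import Function.Construct.Composition using (_↔-∘_; _↣-∘_; _⇔-∘_)
open import Function.Construct.Symmetry using (⇔-sym)
open import Function.Properties.Inverse using (↔-sym; ↔-refl; ↔⇒↣)
open import Level using (0ℓ)
open import Relation.Binary.Definitions using (DecidableEquality)
open import Relation.Binary.PropositionalEquality
  using (_≡_; _≢_; refl; sym; trans; cong; cong₂; subst; subst₂; module ≡-Reasoning)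
open import Relation.Nullary using (¬_; Dec; yes; no; does; contradiction)
open import Relation.Nullary.Decidable using (map′; recompute; via-injection; dec-true; decidable-stable; ¬?; _×-dec_; _→-dec_)
open import Relation.Unary using (Pred; Decidable)

private
  variable
    A B C : Set
    a b k n r : ℕ

k≤a⊎k≤b : ∀ {k n a b} → 2 * k ∸ 1 ≤ n → n ≤ a + b → k ≤ a ⊎ k ≤ b
k≤a⊎k≤b {k} {n} {a} {b} 2k∸1≤n n≤a+b with k ≤? a | k ≤? b
... | yes k≤a | _ = inj₁ k≤a
... | no _ | yes k≤b = inj₂ k≤b
... | no k≰a | no k≰b = contradiction (≤-trans a+b<2k∸1 (≤-trans 2k∸1≤n n≤a+b)) (<-irrefl refl)
  where
  a+b<2k∸1 : a + b < 2 * k ∸ 1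
  a+b<2k∸1 = m+n≤o⇒m≤o∸n (suc (a + b)) (subst₂ _≤_ (shift a b) (double k) (+-mono-≤ (≰⇒> k≰a) (≰⇒> k≰b)))
    where
    shift : ∀ a b → suc a + suc b ≡ suc (a + b) + 1
    shift = solve-∀
    double : ∀ k → k + k ≡ 2 * k
    double = solve-∀

few-degenerate : ∀ m {A Qk s u T} → .{{NonZero A}} → .{{NonZero Qk}} →
  (2 + m) * A ≤ u → s * (u * Qk) ≤ A * (Qk * T) → (2 + m) * s ≤ T
few-degenerate m {A} {Qk} {s} {u} {T} mA≤u count = *-cancelʳ-≤ ((2 + m) * s) T (A * Qk) {{m*n≢0 A Qk}} (begin
  (2 + m) * s * (A * Qk)   ≡⟨ regroup (2 + m) s A Qk ⟩
  s * ((2 + m) * A * Qk)   ≤⟨ *-monoʳ-≤ s (*-monoˡ-≤ Qk mA≤u) ⟩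
  s * (u * Qk)             ≤⟨ count ⟩
  A * (Qk * T)             ≡⟨ rotate A Qk T ⟩
  T * (A * Qk)             ∎)
  where
  open ℕ.≤-Reasoning
  regroup : ∀ a s A Qk → a * s * (A * Qk) ≡ s * (a * A * Qk)
  regroup = solve-∀
  rotate : ∀ A Qk T → A * (Qk * T) ≡ T * (A * Qk)
  rotate = solve-∀

few-nonintersecting : ∀ m {s T N M g} → .{{NonZero g}} →
  (2 + m) * s ≤ T → T ≤ s + g * N → g * N ≤ s + g * M → suc m * (N ∸ M) ≤ N
few-nonintersecting m {s} {T} {N} {M} {g} [2+m]s≤T T≤s+gN gN≤s+gM = *-cancelˡ-≤ g (begin
  g * (suc m * (N ∸ M))   ≡⟨ swap g (suc m) (N ∸ M) ⟩
  suc m * (g * (N ∸ M))   ≤⟨ *-monoʳ-≤ (suc m) g[N∸M]≤s ⟩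
  suc m * s               ≤⟨ +-cancelˡ-≤ s _ _ (≤-trans [2+m]s≤T T≤s+gN) ⟩
  g * N                   ∎)
  where
  open ℕ.≤-Reasoning
  swap : ∀ a b c → a * (b * c) ≡ b * (a * c)
  swap = solve-∀
  g[N∸M]≤s : g * (N ∸ M) ≤ s
  g[N∸M]≤s = subst (_≤ s) (sym (*-distribˡ-∸ g N M))
    (m≤n+o⇒m∸n≤o (g * N) (g * M) (subst (g * N ≤_) (ℕ.+-comm s (g * M)) gN≤s+gM))

2*suc[k]∸1≡suc[k+k] : ∀ k → 2 * suc k ∸ 1 ≡ suc (k + k)
2*suc[k]∸1≡suc[k+k] k = trans (ℕ.+-suc k (k + 0)) (cong (λ m → suc (k + m)) (ℕ.+-identityʳ k))

k≤2k∸1 : ∀ {k} → 1 ≤ k → k ≤ 2 * k ∸ 1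
k≤2k∸1 {suc k} _ = subst (suc k ≤_) (sym (2*suc[k]∸1≡suc[k+k] k)) (s≤s (m≤m+n k k))

split-below : ∀ {n k} → n < 2 * k ∸ 1 → ∃₂ λ a b → n ≡ a + b × a < k × b < k
split-below {n} {suc k} n<2k∸1 with n ≤? k
... | yes n≤k = n , 0 , sym (ℕ.+-identityʳ n) , s≤s n≤k , s≤s z≤n
... | no n≰k = k , n ∸ k , sym (m+[n∸m]≡n (<⇒≤ (≰⇒> n≰k))) , ≤-refl , s≤s (m≤n+o⇒m∸n≤o n k n≤k+k)
  where
  n≤k+k : n ≤ k + k
  n≤k+k = ≤-pred (subst (suc n ≤_) (2*suc[k]∸1≡suc[k+k] k) n<2k∸1)

injection⇒≤ : A ↔ Fin a → B ↔ Fin b → A ↣ B → a ≤ b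
injection⇒≤ A↔ B↔ A↣B = injective⇒≤ (Injection.injective (↔⇒↣ B↔ ↣-∘ (A↣B ↣-∘ ↔⇒↣ (↔-sym A↔))))

collision : A ↔ Fin a → B ↔ Fin b → b < a → (f : A → B) → ∃₂ λ x y → x ≢ y × f x ≡ f y
collision A↔ B↔ b<a f with pigeonhole b<a (Inverse.to B↔ ∘ f ∘ Inverse.from A↔)
... | i , j , i<j , eq = from i , from j , (λ eq′ → <⇒≢ i<j (Injection.injective (↔⇒↣ (↔-sym A↔)) eq′))
                       , Injection.injective (↔⇒↣ B↔) eq
  where open Inverse A↔

≟-via-↔ : A ↔ Fin a → DecidableEquality A
≟-via-↔ A↔ = via-injection (↔⇒↣ A↔) _≟ᶠ_

∃?-via-↔ : {P : Pred A 0ℓ} → A ↔ Fin a → Decidable P → Dec (∃ P)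
∃?-via-↔ {P = P} A↔ P? =
  map′ (λ (i , p) → from i , p) (λ (x , p) → to x , subst P (sym (strictlyInverseʳ x)) p) (any? (P? ∘ from))
  where open Inverse A↔

×-size : A ↔ Fin a → B ↔ Fin b → (A × B) ↔ Fin (a * b)
×-size A↔ B↔ = ↔-sym *↔× ↔-∘ (A↔ ×-↔ B↔)

⊎-size : A ↔ Fin a → B ↔ Fin b → (A ⊎ B) ↔ Fin (a + b)
⊎-size A↔ B↔ = ↔-sym (+↔⊎ {_}) ↔-∘ (A↔ ⊎-↔ B↔)

Vec-size : A ↔ Fin a → ∀ n → Vec A n ↔ Fin (a ^ n)
Vec-size A↔ zero = mk↔ₛ′ (λ _ → zero) (λ _ → []) (λ { zero → refl }) (λ { [] → refl })
Vec-size A↔ (suc n) = ×-size A↔ (Vec-size A↔ n) ↔-∘ uncons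
  where
  uncons : Vec _ (suc n) ↔ (_ × Vec _ n)
  uncons = mk↔ₛ′ (λ { (x ∷ xs) → x , xs }) (uncurry _∷_) (λ _ → refl) (λ { (x ∷ xs) → refl })

refinement-↔ : {P : Pred A 0ℓ} (A↔ : A ↔ B) → [ x ∈ A ∣ P x ] ↔ [ y ∈ B ∣ P (Inverse.from A↔ y) ]
refinement-↔ {P = P} A↔ = mk↔ₛ′ (Refinement.map to (subst P (sym (strictlyInverseʳ _)))) (Refinement.map from id)
  (λ _ → value-injective (strictlyInverseˡ _)) (λ _ → value-injective (strictlyInverseʳ _))
  where open Inverse A↔

Fin-refinement-size : {P : Pred (Fin a) 0ℓ} → Decidable P → ∃ λ m → [ i ∈ Fin a ∣ P i ] ↔ Fin m
Fin-refinement-size {zero} P? = 0 , mk↔ₛ′ (λ { (() , _) }) (λ ()) (λ ()) (λ { (() , _) })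
Fin-refinement-size {suc a} {P} P? with Fin-refinement-size {a} (P? ∘ suc) | P? zero
... | m , e | yes p0 = suc m , mk↔ₛ′ to from to∘from from∘to
  where
  open Inverse e renaming (to to to′; from to from′)
  to : [ i ∈ Fin (suc a) ∣ P i ] → Fin (suc m)
  to (zero , _) = zero
  to (suc i , p) = suc (to′ (i , p))
  from : Fin (suc m) → [ i ∈ Fin (suc a) ∣ P i ]
  from zero = zero , [ p0 ]
  from (suc j) = Refinement.map suc id (from′ j)
  to∘from : ∀ j → to (from j) ≡ j
  to∘from zero = refl
  to∘from (suc j) = cong suc (strictlyInverseˡ j)
  from∘to : ∀ i → from (to i) ≡ i
  from∘to (zero , _) = refl
  from∘to (suc i , p) = value-injective (cong (suc ∘ value) (strictlyInverseʳ (i , p)))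
... | m , e | no ¬p0 = m , mk↔ₛ′ to (Refinement.map suc id ∘ from′) strictlyInverseˡ from∘to
  where
  open Inverse e renaming (to to to′; from to from′)
  to : [ i ∈ Fin (suc a) ∣ P i ] → Fin m
  to (zero , [ p ]) = contradiction (recompute (P? zero) p) ¬p0
  to (suc i , p) = to′ (i , p)
  from∘to : ∀ i → Refinement.map suc id (from′ (to i)) ≡ i
  from∘to (zero , [ p ]) = contradiction (recompute (P? zero) p) ¬p0
  from∘to (suc i , p) = value-injective (cong (suc ∘ value) (strictlyInverseʳ (i , p)))

refinement-size : {P : Pred A 0ℓ} → A ↔ Fin a → Decidable P → ∃ λ m → [ x ∈ A ∣ P x ] ↔ Fin m
refinement-size A↔ P? with Fin-refinement-size (P? ∘ Inverse.from A↔)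
... | m , e = m , e ↔-∘ refinement-↔ A↔

injection-by-cases : {P : Pred A 0ℓ} → Decidable P → (f : ∀ x → P x → B) → (g : ∀ x → ¬ P x → C) →
  (∀ {x y} p q → f x p ≡ f y q → x ≡ y) → (∀ {x y} p q → g x p ≡ g y q → x ≡ y) → A ↣ (B ⊎ C)
injection-by-cases {A} {B} {C} {P} P? f g f-inj g-inj = mk↣ h-inj
  where
  h : A → B ⊎ C
  h x with P? x
  ... | yes p = inj₁ (f x p)
  ... | no ¬p = inj₂ (g x ¬p)
  h-inj : Injective _≡_ _≡_ h
  h-inj {x} {y} eq with P? x | P? y
  ... | yes p | yes q = f-inj p q (inj₁-injective eq)
  ... | no ¬p | no ¬q = g-inj ¬p ¬q (inj₂-injective eq)
  ... | yes _ | no _ with () ← eq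
  ... | no _ | yes _ with () ← eq

does⇒ : ∀ {A : Set} (a? : Dec A) → does a? ≡ true → A
does⇒ (yes a) _ = a

refinement-proof : {P : Pred A 0ℓ} → Decidable P → (r : [ x ∈ A ∣ P x ]) → P (value r)
refinement-proof P? (x , [ p ]) = recompute (P? x) p

Vec-ext : {u w : Vec A n} → (∀ p → lookup u p ≡ lookup w p) → u ≡ w
Vec-ext {u = u} {w} eq = trans (sym (tabulate∘lookup u)) (trans (tabulate-cong eq) (tabulate∘lookup w))

module _ (F : FiniteField) where
  open FiniteField F
  open ≡-Reasoning

  private
    ring : CommutativeRing 0ℓ 0ℓ
    ring = record { isCommutativeRing = isCommutativeRing }
  open CommutativeRing ring using (_-_; *-comm; *-assoc; *-identityˡ; *-identityʳ; zeroˡ; zeroʳ; -‿inverseʳ; +-identityʳ)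
  open RingProperties (CommutativeRing.ring ring) using ([y-z]x≈yx-zx; -0#≈0#; x∙y⁻¹≈ε⇒x≈y; +-cancelʳ; -‿+-comm)
  open import Algebra.Properties.Semiring.Sum (CommutativeRing.semiring ring)
    using (sum; sum-syntax; sum-cong-≗; sum-remove; sum-replicate-zero; ∑-distrib-+; ∑-comm; *-distribˡ-sum; *-distribʳ-sum)

  _≟_ : (x y : Carrier) → Dec (x ≡ y)
  _≟_ = ≟-via-↔ enum

  *-cancelʳ-nonzero : ∀ {a} x y → a ≢ 0F → x *F a ≡ y *F a → x ≡ y
  *-cancelʳ-nonzero {a} x y a≢0 xa≡ya with inverse a a≢0
  ... | b , ab≡1 = begin
    x                ≡⟨ sym (*-identityʳ x) ⟩
    x *F 1F          ≡⟨ cong (x *F_) ab≡1 ⟨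
    x *F (a *F b)    ≡⟨ *-assoc x a b ⟨
    (x *F a) *F b    ≡⟨ cong (_*F b) xa≡ya ⟩
    (y *F a) *F b    ≡⟨ *-assoc y a b ⟩
    y *F (a *F b)    ≡⟨ cong (y *F_) ab≡1 ⟩
    y *F 1F          ≡⟨ *-identityʳ y ⟩
    y                ∎

  *-nonzero : ∀ {a b} → a ≢ 0F → b ≢ 0F → a *F b ≢ 0F
  *-nonzero {a} {b} a≢0 b≢0 ab≡0 = a≢0 (*-cancelʳ-nonzero a 0F b≢0 (trans ab≡0 (sym (zeroˡ b))))

  ∑-neg : ∀ {k} (f : Fin k → Carrier) → ∑[ l < k ] (-F f l) ≡ -F (∑[ l < k ] f l)
  ∑-neg {zero} f = sym -0#≈0#
  ∑-neg {suc k} f = trans (cong (-F f zero +F_) (∑-neg (f ∘ suc))) (-‿+-comm (f zero) _)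

  ∑-pick : ∀ {k} (f : Fin k → Carrier) i → (∀ j → j ≢ i → f j ≡ 0F) → ∑[ j < k ] f j ≡ f i
  ∑-pick {suc k} f i others-zero = begin
    sum f                                  ≡⟨ sum-remove f ⟩
    f i +F ∑[ j < k ] f (punchIn i j)      ≡⟨ cong (f i +F_) (sum-cong-≗ (λ j → others-zero _ (punchInᵢ≢i i j))) ⟩
    f i +F ∑[ j < k ] 0F                   ≡⟨ cong (f i +F_) (sum-replicate-zero k) ⟩
    f i +F 0F                              ≡⟨ +-identityʳ (f i) ⟩
    f i                                    ∎

  ∑-determines-term : ∀ {k} (c x y : Fin k → Carrier) i → c i ≢ 0F → (∀ l → l ≢ i → x l ≡ y l) →
    ∑[ l < k ] (c l *F x l) ≡ ∑[ l < k ] (c l *F y l) → x i ≡ y i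
  ∑-determines-term {suc k} c x y i cᵢ≢0 others-equal ∑≡∑ = *-cancelʳ-nonzero (x i) (y i) cᵢ≢0
    (trans (*-comm (x i) (c i)) (trans (+-cancelʳ rest _ _ (begin
      c i *F x i +F rest
        ≡⟨ cong (c i *F x i +F_) (sum-cong-≗ (λ l → cong (c (punchIn i l) *F_) (others-equal _ (punchInᵢ≢i i l)))) ⟨
      c i *F x i +F ∑[ l < k ] (c (punchIn i l) *F x (punchIn i l))  ≡⟨ sum-remove (λ l → c l *F x l) ⟨
      ∑[ l < suc k ] (c l *F x l)                                   ≡⟨ ∑≡∑ ⟩
      ∑[ l < suc k ] (c l *F y l)                                   ≡⟨ sum-remove (λ l → c l *F y l) ⟩
      c i *F y i +F rest                                            ∎)) (*-comm (c i) (y i))))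
    where
    rest : Carrier
    rest = ∑[ l < k ] (c (punchIn i l) *F y (punchIn i l))

  lookup-lincomb : ∀ k (c : Fin k → Carrier) (v : Fin k → Vect F n) p →
    lookup (lincomb F k c v) p ≡ ∑[ l < k ] (c l *F lookup (v l) p)
  lookup-lincomb zero c v p = lookup-replicate p 0F
  lookup-lincomb (suc k) c v p = begin
    lookup (zipWith _+F_ (map (c zero *F_) (v zero)) (lincomb F k (c ∘ suc) (v ∘ suc))) p
      ≡⟨ lookup-zipWith _+F_ p (map (c zero *F_) (v zero)) (lincomb F k (c ∘ suc) (v ∘ suc)) ⟩
    lookup (map (c zero *F_) (v zero)) p +F lookup (lincomb F k (c ∘ suc) (v ∘ suc)) p
      ≡⟨ cong₂ _+F_ (lookup-map p _ (v zero)) (lookup-lincomb k (c ∘ suc) (v ∘ suc) p) ⟩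
    c zero *F lookup (v zero) p +F ∑[ l < k ] (c (suc l) *F lookup (v (suc l)) p)
      ∎

  lincomb-cong : ∀ k {c d : Fin k → Carrier} {v w : Fin k → Vect F n} → (∀ l → c l ≡ d l) → (∀ l → v l ≡ w l) →
    lincomb F k c v ≡ lincomb F k d w
  lincomb-cong k {c} {d} {v} {w} c≗d v≗w = Vec-ext λ p → begin
    lookup (lincomb F k c v) p                ≡⟨ lookup-lincomb k c v p ⟩
    ∑[ l < k ] (c l *F lookup (v l) p)        ≡⟨ sum-cong-≗ (λ l → cong₂ (λ a x → a *F lookup x p) (c≗d l) (v≗w l)) ⟩
    ∑[ l < k ] (d l *F lookup (w l) p)        ≡⟨ lookup-lincomb k d w p ⟨
    lookup (lincomb F k d w) p                ∎

  Mat : ℕ → ℕ → Set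
  Mat r n = Vec (Vect F n) r

  infixl 7 _⊛_ _⊡_ _·ᵥ_
  infixl 6 _−ᵥ_

  _⊛_ : Vect F k → Mat k n → Vect F n
  c ⊛ M = lincomb F _ (lookup c) (lookup M)

  _⊡_ : Mat r k → Mat k n → Mat r n
  P ⊡ M = map (_⊛ M) P

  I : Mat k k
  I = tabulate (λ i → zeroV F [ i ]≔ 1F)

  _·ᵥ_ : Carrier → Vect F n → Vect F n
  a ·ᵥ c = map (a *F_) c

  _−ᵥ_ : Vect F n → Vect F n → Vect F n
  u −ᵥ w = zipWith _-_ u w

  lookup-⊛ : ∀ (c : Vect F k) (M : Mat k n) p → lookup (c ⊛ M) p ≡ ∑[ l < k ] (lookup c l *F lookup (lookup M l) p)
  lookup-⊛ c M = lookup-lincomb _ (lookup c) (lookup M)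

  lookup-⊡ : ∀ (P : Mat r k) (M : Mat k n) i → lookup (P ⊡ M) i ≡ lookup P i ⊛ M
  lookup-⊡ P M i = lookup-map i (_⊛ M) P

  ⊛-assoc : ∀ (c : Vect F r) (P : Mat r k) (M : Mat k n) → c ⊛ (P ⊡ M) ≡ c ⊛ P ⊛ M
  ⊛-assoc {r} {k} {n} c P M = Vec-ext λ p → begin
    lookup (c ⊛ (P ⊡ M)) p
      ≡⟨ lookup-⊛ c (P ⊡ M) p ⟩
    ∑[ i < r ] (c′ i *F lookup (lookup (P ⊡ M) i) p)
      ≡⟨ sum-cong-≗ (λ i → cong (λ row → c′ i *F lookup row p) (lookup-⊡ P M i)) ⟩
    ∑[ i < r ] (c′ i *F lookup (lookup P i ⊛ M) p)
      ≡⟨ sum-cong-≗ (λ i → trans (cong (c′ i *F_) (lookup-⊛ (lookup P i) M p))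
                                  (*-distribˡ-sum (c′ i) (λ l → P′ i l *F M′ l p))) ⟩
    ∑[ i < r ] ∑[ l < k ] (c′ i *F (P′ i l *F M′ l p))
      ≡⟨ ∑-comm (λ i l → c′ i *F (P′ i l *F M′ l p)) ⟩
    ∑[ l < k ] ∑[ i < r ] (c′ i *F (P′ i l *F M′ l p))
      ≡⟨ sum-cong-≗ (λ l → trans (sum-cong-≗ (λ i → sym (*-assoc (c′ i) (P′ i l) (M′ l p))))
                                  (sym (*-distribʳ-sum (M′ l p) (λ i → c′ i *F P′ i l)))) ⟩
    ∑[ l < k ] (∑[ i < r ] (c′ i *F P′ i l) *F M′ l p)
      ≡⟨ sum-cong-≗ (λ l → cong (_*F M′ l p) (lookup-⊛ c P l)) ⟨
    ∑[ l < k ] (lookup (c ⊛ P) l *F M′ l p)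
      ≡⟨ lookup-⊛ (c ⊛ P) M p ⟨
    lookup (c ⊛ P ⊛ M) p
      ∎
    where
    c′ : Fin r → Carrier
    c′ = lookup c
    P′ : Fin r → Fin k → Carrier
    P′ i l = lookup (lookup P i) l
    M′ : Fin k → Fin n → Carrier
    M′ l p = lookup (lookup M l) p

  ⊡-assoc : ∀ (Q : Mat r k) (P : Mat k k) (M : Mat k n) → Q ⊡ P ⊡ M ≡ Q ⊡ (P ⊡ M)
  ⊡-assoc Q P M = trans (sym (map-∘ (_⊛ M) (_⊛ P) Q)) (map-cong (λ c → sym (⊛-assoc c P M)) Q)

  lookup-I : ∀ (i j : Fin k) → i ≢ j → lookup (lookup I i) j ≡ 0F
  lookup-I i j i≢j = trans (cong (λ row → lookup row j) (lookup∘tabulate _ i))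
    (trans (lookup∘update′ (i≢j ∘ sym) (zeroV F) 1F) (lookup-replicate j 0F))

  lookup-I-diagonal : ∀ (i : Fin k) → lookup (lookup I i) i ≡ 1F
  lookup-I-diagonal i = trans (cong (λ row → lookup row i) (lookup∘tabulate _ i)) (lookup∘update i (zeroV F) 1F)

  ⊛-identityʳ : ∀ (c : Vect F k) → c ⊛ I ≡ c
  ⊛-identityʳ {k} c = Vec-ext λ p → begin
    lookup (c ⊛ I) p                                 ≡⟨ lookup-⊛ c I p ⟩
    ∑[ l < k ] (lookup c l *F lookup (lookup I l) p)
      ≡⟨ ∑-pick _ p (λ l l≢p → trans (cong (lookup c l *F_) (lookup-I l p l≢p)) (zeroʳ _)) ⟩
    lookup c p *F lookup (lookup I p) p              ≡⟨ cong (lookup c p *F_) (lookup-I-diagonal p) ⟩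
    lookup c p *F 1F                                 ≡⟨ *-identityʳ _ ⟩
    lookup c p                                       ∎

  ⊡-identityˡ : ∀ (M : Mat k n) → I ⊡ M ≡ M
  ⊡-identityˡ {k} M = Vec-ext λ i → Vec-ext λ p → begin
    lookup (lookup (I ⊡ M) i) p                      ≡⟨ cong (λ row → lookup row p) (lookup-⊡ I M i) ⟩
    lookup (lookup I i ⊛ M) p                        ≡⟨ lookup-⊛ (lookup I i) M p ⟩
    ∑[ l < k ] (lookup (lookup I i) l *F lookup (lookup M l) p)
      ≡⟨ ∑-pick _ i (λ l l≢i → trans (cong (_*F _) (lookup-I i l (l≢i ∘ sym))) (zeroˡ _)) ⟩
    lookup (lookup I i) i *F lookup (lookup M i) p   ≡⟨ cong (_*F lookup (lookup M i) p) (lookup-I-diagonal i) ⟩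
    1F *F lookup (lookup M i) p                      ≡⟨ *-identityˡ _ ⟩
    lookup (lookup M i) p                            ∎

  ⊛-zeroˡ : ∀ (M : Mat k n) → zeroV F ⊛ M ≡ zeroV F
  ⊛-zeroˡ {k} M = Vec-ext λ p → begin
    lookup (zeroV F ⊛ M) p                                   ≡⟨ lookup-⊛ (zeroV F) M p ⟩
    ∑[ l < k ] (lookup (zeroV F) l *F lookup (lookup M l) p)
      ≡⟨ sum-cong-≗ (λ l → trans (cong (_*F lookup (lookup M l) p) (lookup-replicate l 0F)) (zeroˡ _)) ⟩
    ∑[ l < k ] 0F                                            ≡⟨ sum-replicate-zero k ⟩
    0F                                                       ≡⟨ lookup-replicate p 0F ⟨
    lookup (zeroV F) p                                       ∎

  lookup-·ᵥ-⊛ : ∀ a (c : Vect F k) (M : Mat k n) p → lookup (a ·ᵥ c ⊛ M) p ≡ a *F lookup (c ⊛ M) p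
  lookup-·ᵥ-⊛ {k} a c M p = begin
    lookup (a ·ᵥ c ⊛ M) p                                   ≡⟨ lookup-⊛ (a ·ᵥ c) M p ⟩
    ∑[ l < k ] (lookup (a ·ᵥ c) l *F lookup (lookup M l) p)
      ≡⟨ sum-cong-≗ (λ l → trans (cong (_*F _) (lookup-map l _ c)) (*-assoc _ _ _)) ⟩
    ∑[ l < k ] (a *F (lookup c l *F lookup (lookup M l) p))
      ≡⟨ *-distribˡ-sum a (λ l → lookup c l *F lookup (lookup M l) p) ⟨
    a *F ∑[ l < k ] (lookup c l *F lookup (lookup M l) p)   ≡⟨ cong (a *F_) (lookup-⊛ c M p) ⟨
    a *F lookup (c ⊛ M) p                                   ∎

  lookup-−ᵥ-⊛ : ∀ (u w : Vect F k) (M : Mat k n) p → lookup ((u −ᵥ w) ⊛ M) p ≡ lookup (u ⊛ M) p - lookup (w ⊛ M) p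
  lookup-−ᵥ-⊛ {k} u w M p = begin
    lookup ((u −ᵥ w) ⊛ M) p
      ≡⟨ lookup-⊛ (u −ᵥ w) M p ⟩
    ∑[ l < k ] (lookup (u −ᵥ w) l *F M′ l)
      ≡⟨ sum-cong-≗ (λ l → trans (cong (_*F M′ l) (lookup-zipWith _-_ l u w)) ([y-z]x≈yx-zx _ _ _)) ⟩
    ∑[ l < k ] (lookup u l *F M′ l - lookup w l *F M′ l)
      ≡⟨ ∑-distrib-+ (λ l → lookup u l *F M′ l) (λ l → -F (lookup w l *F M′ l)) ⟩
    ∑[ l < k ] (lookup u l *F M′ l) +F ∑[ l < k ] (-F (lookup w l *F M′ l))
      ≡⟨ cong (∑[ l < k ] (lookup u l *F M′ l) +F_) (∑-neg (λ l → lookup w l *F M′ l)) ⟩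
    ∑[ l < k ] (lookup u l *F M′ l) - ∑[ l < k ] (lookup w l *F M′ l)
      ≡⟨ cong₂ _-_ (lookup-⊛ u M p) (lookup-⊛ w M p) ⟨
    lookup (u ⊛ M) p - lookup (w ⊛ M) p
      ∎
    where
    M′ : Fin k → Carrier
    M′ l = lookup (lookup M l) p

  −ᵥ≡zeroV⇒≡ : ∀ {u w : Vect F n} → u −ᵥ w ≡ zeroV F → u ≡ w
  −ᵥ≡zeroV⇒≡ {u = u} {w} u−w≡0 = Vec-ext λ p → x∙y⁻¹≈ε⇒x≈y _ _
    (trans (sym (lookup-zipWith _-_ p u w)) (trans (cong (λ z → lookup z p) u−w≡0) (lookup-replicate p 0F)))

  Independent : Mat k n → Set
  Independent M = ∀ c → c ⊛ M ≡ zeroV F → c ≡ zeroV F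

  ⊛-injective : ∀ {M : Mat k n} → Independent M → ∀ {u w} → u ⊛ M ≡ w ⊛ M → u ≡ w
  ⊛-injective {M = M} independent {u} {w} uM≡wM = −ᵥ≡zeroV⇒≡ (independent (u −ᵥ w) (Vec-ext λ p → begin
    lookup ((u −ᵥ w) ⊛ M) p                ≡⟨ lookup-−ᵥ-⊛ u w M p ⟩
    lookup (u ⊛ M) p - lookup (w ⊛ M) p  ≡⟨ cong (λ x → lookup x p - lookup (w ⊛ M) p) uM≡wM ⟩
    lookup (w ⊛ M) p - lookup (w ⊛ M) p  ≡⟨ -‿inverseʳ _ ⟩
    0F                                   ≡⟨ lookup-replicate p 0F ⟨
    lookup (zeroV F) p                   ∎))

  ⊡-cancelʳ : ∀ {M : Mat k n} → Independent M → ∀ {P Q : Mat r k} → P ⊡ M ≡ Q ⊡ M → P ≡ Q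
  ⊡-cancelʳ {M = M} independent {P} {Q} PM≡QM = Vec-ext λ i → ⊛-injective {M = M} independent
    (trans (sym (lookup-⊡ P M i)) (trans (cong (λ N → lookup N i) PM≡QM) (lookup-⊡ Q M i)))

  Vect-size : ∀ n → Vect F n ↔ Fin (size ^ n)
  Vect-size = Vec-size enum

  Mat-size : ∀ k n → Mat k n ↔ Fin ((size ^ n) ^ k)
  Mat-size k n = Vec-size (Vect-size n) k

  2≤size : 2 ≤ size
  2≤size = injection⇒≤ ↔-refl enum (mk↣ 0or1-injective)
    where
    0or1 : Fin 2 → Carrier
    0or1 zero = 0F
    0or1 (suc zero) = 1F
    0or1-injective : Injective _≡_ _≡_ 0or1
    0or1-injective {zero} {zero} _ = refl
    0or1-injective {zero} {suc zero} 0≡1 = contradiction 0≡1 0≢1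
    0or1-injective {suc zero} {zero} 1≡0 = contradiction (sym 1≡0) 0≢1
    0or1-injective {suc zero} {suc zero} _ = refl

  vanishing-combination : ∀ {a} (M : Mat k n) (t : Fin a → Fin n) → a < k →
    ∃ λ c → c ≢ zeroV F × ∀ j → lookup (c ⊛ M) (t j) ≡ 0F
  vanishing-combination {k} {n} {a} M t a<k
    with collision (Vect-size k) (Vect-size a) (^-monoʳ-< size 2≤size a<k) restrict
    where restrict : Vect F k → Vect F a
          restrict c = tabulate (λ j → lookup (c ⊛ M) (t j))
  ... | u , w , u≢w , same-restriction = u −ᵥ w , u≢w ∘ −ᵥ≡zeroV⇒≡ , λ j → begin
    lookup ((u −ᵥ w) ⊛ M) (t j)                    ≡⟨ lookup-−ᵥ-⊛ u w M (t j) ⟩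
    lookup (u ⊛ M) (t j) - lookup (w ⊛ M) (t j)    ≡⟨ cong (_- lookup (w ⊛ M) (t j)) (agree j) ⟩
    lookup (w ⊛ M) (t j) - lookup (w ⊛ M) (t j)    ≡⟨ -‿inverseʳ _ ⟩
    0F                                             ∎
    where
    agree : ∀ j → lookup (u ⊛ M) (t j) ≡ lookup (w ⊛ M) (t j)
    agree j = trans (sym (lookup∘tabulate _ j)) (trans (cong (λ v → lookup v j) same-restriction) (lookup∘tabulate _ j))

  infix 4 _∈⟨_⟩
  _∈⟨_⟩ : Vect F n → Mat k n → Set
  x ∈⟨ M ⟩ = ∃ λ c → x ≡ c ⊛ M

  _∈⟨_⟩? : ∀ x (M : Mat k n) → Dec (x ∈⟨ M ⟩)
  x ∈⟨ M ⟩? = ∃?-via-↔ (Vect-size _) (λ c → ≡-dec _≟_ x (c ⊛ M))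

  row-∈⟨⟩ : ∀ (M : Mat k n) i → lookup M i ∈⟨ M ⟩
  row-∈⟨⟩ M i = lookup I i , trans (cong (λ N → lookup N i) (sym (⊡-identityˡ M))) (lookup-⊡ I M i)

  rows-∈⟨⟩⇒factor : ∀ {M : Mat r n} {B : Mat k n} (rows : ∀ i → lookup M i ∈⟨ B ⟩) → M ≡ tabulate (proj₁ ∘ rows) ⊡ B
  rows-∈⟨⟩⇒factor {B = B} rows = Vec-ext λ i → trans (proj₂ (rows i))
    (trans (cong (_⊛ B) (sym (lookup∘tabulate (proj₁ ∘ rows) i))) (sym (lookup-⊡ (tabulate (proj₁ ∘ rows)) B i)))

  ⊛-lincomb : ∀ (c : Vect F k) (v : Fin k → Vect F n) → c ⊛ tabulate v ≡ lincomb F k (lookup c) v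
  ⊛-lincomb c v = lincomb-cong _ (λ _ → refl) (lookup∘tabulate v)

  lincomb-⊛ : ∀ (c : Fin k → Carrier) (M : Mat k n) → lincomb F k c (lookup M) ≡ tabulate c ⊛ M
  lincomb-⊛ c M = lincomb-cong _ (λ l → sym (lookup∘tabulate c l)) (λ _ → refl)

  rowSpace : Mat k n → SubsetV F n
  rowSpace M x = does (x ∈⟨ M ⟩?)

  ∈rowSpace⇔∈⟨⟩ : ∀ (M : Mat k n) x → rowSpace M x ≡ true ⇔ x ∈⟨ M ⟩
  ∈rowSpace⇔∈⟨⟩ M x = mk⇔ (does⇒ (x ∈⟨ M ⟩?)) (dec-true (x ∈⟨ M ⟩?))

  rowSpace-isCode : ∀ {M : Mat k n} → Independent M → IsCode F n k (rowSpace M)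
  rowSpace-isCode {k} {M = M} independent = lookup M , linIndep , λ x →
      (λ x∈ → let c , x≡cM = Equivalence.to (∈rowSpace⇔∈⟨⟩ M x) x∈ in lookup c , x≡cM)
    , (λ (c , x≡) → Equivalence.from (∈rowSpace⇔∈⟨⟩ M x) (tabulate c , trans x≡ (lincomb-⊛ c M)))
    where
    linIndep : LinIndep F k (lookup M)
    linIndep c c≡0 i = trans (sym (lookup∘tabulate c i))
      (trans (cong (λ v → lookup v i) (independent (tabulate c) (trans (sym (lincomb-⊛ c M)) c≡0))) (lookup-replicate i 0F))

  LeftInvertible : Mat k k → Set
  LeftInvertible {k} P = ∃ λ (Q : Mat k k) → Q ⊡ P ≡ I

  -- Over a field a left inverse of a square matrix is two-sided, so this is GL_k.
  GL : ℕ → Set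
  GL k = [ P ∈ Mat k k ∣ LeftInvertible P ]

  leftInvertible? : (P : Mat k k) → Dec (LeftInvertible P)
  leftInvertible? {k} P = ∃?-via-↔ (Mat-size k k) (λ Q → ≡-dec (≡-dec _≟_) (Q ⊡ P) I)

  GL-size : ∀ k → ∃ λ g → GL k ↔ Fin g
  GL-size k = refinement-size (Mat-size k k) leftInvertible?

  GL-leftInvertible : (P : GL k) → LeftInvertible (value P)
  GL-leftInvertible = refinement-proof leftInvertible?

  I∈GL : GL k
  I∈GL = I , [ I , ⊡-identityˡ I ]

  1≤GL-size : ∀ {g} → GL k ↔ Fin g → 1 ≤ g
  1≤GL-size GL↔ = injection⇒≤ (↔-sym 1↔⊤) GL↔ (mk↣ {to = λ _ → I∈GL} (λ _ → refl))

  ⊛-left-inverse : ∀ {P Q : Mat k k} → Q ⊡ P ≡ I → ∀ c → c ⊛ Q ⊛ P ≡ c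
  ⊛-left-inverse {P = P} {Q} QP≡I c = trans (sym (⊛-assoc c Q P)) (trans (cong (c ⊛_) QP≡I) (⊛-identityʳ c))

  ∈⟨⊡⟩⇒∈⟨⟩ : ∀ {x} (P : Mat r k) (B : Mat k n) → x ∈⟨ P ⊡ B ⟩ → x ∈⟨ B ⟩
  ∈⟨⊡⟩⇒∈⟨⟩ P B (c , x≡) = c ⊛ P , trans x≡ (⊛-assoc c P B)

  ∈⟨⟩⇒∈⟨⊡⟩ : ∀ {x} {P : Mat k k} (B : Mat k n) → LeftInvertible P → x ∈⟨ B ⟩ → x ∈⟨ P ⊡ B ⟩
  ∈⟨⟩⇒∈⟨⊡⟩ {P = P} B (Q , QP≡I) (c , x≡) =
    c ⊛ Q , trans x≡ (trans (cong (_⊛ B) (sym (⊛-left-inverse {P = P} {Q} QP≡I c))) (sym (⊛-assoc (c ⊛ Q) P B)))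

  SameRowSpace : Mat k n → Mat r n → Set
  SameRowSpace M N = ∀ x → x ∈⟨ M ⟩ ⇔ x ∈⟨ N ⟩

  ⊡-SameRowSpace : ∀ {P : Mat k k} (B : Mat k n) → LeftInvertible P → SameRowSpace (P ⊡ B) B
  ⊡-SameRowSpace {P = P} B P-invertible x = mk⇔ (∈⟨⊡⟩⇒∈⟨⟩ P B) (∈⟨⟩⇒∈⟨⊡⟩ {P = P} B P-invertible)

  SameRowSpace⇒factor : ∀ {M B : Mat k n} → Independent B → SameRowSpace M B →
    ∃ λ P → LeftInvertible P × M ≡ P ⊡ B
  SameRowSpace⇒factor {k} {n} {M} {B} B-independent same =
    P , (Q , ⊡-cancelʳ {M = B} B-independent QPB≡IB) , M≡PB
    where
    M-rows : ∀ i → lookup M i ∈⟨ B ⟩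
    M-rows i = Equivalence.to (same _) (row-∈⟨⟩ M i)
    B-rows : ∀ i → lookup B i ∈⟨ M ⟩
    B-rows i = Equivalence.from (same _) (row-∈⟨⟩ B i)
    P Q : Mat k k
    P = tabulate (proj₁ ∘ M-rows)
    Q = tabulate (proj₁ ∘ B-rows)
    M≡PB : M ≡ P ⊡ B
    M≡PB = rows-∈⟨⟩⇒factor {M = M} {B} M-rows
    QPB≡IB : Q ⊡ P ⊡ B ≡ I ⊡ B
    QPB≡IB = begin
      Q ⊡ P ⊡ B    ≡⟨ ⊡-assoc Q P B ⟩
      Q ⊡ (P ⊡ B)  ≡⟨ cong (Q ⊡_) M≡PB ⟨
      Q ⊡ M        ≡⟨ rows-∈⟨⟩⇒factor {M = B} {M} B-rows ⟨
      B            ≡⟨ ⊡-identityˡ B ⟨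
      I ⊡ B        ∎

  generator : ∀ {S} → IsCode F n k S → Mat k n
  generator (v , _) = tabulate v

  generator-independent : ∀ {S} (S-code : IsCode F n k S) → Independent (generator S-code)
  generator-independent (v , v-independent , _) c cv≡0 = Vec-ext λ i →
    trans (v-independent (lookup c) (trans (sym (⊛-lincomb c v)) cv≡0) i) (sym (lookup-replicate i 0F))

  ∈⇔∈⟨generator⟩ : ∀ {S} (S-code : IsCode F n k S) x → S x ≡ true ⇔ x ∈⟨ generator S-code ⟩
  ∈⇔∈⟨generator⟩ {k = k} (v , _ , spans) x = mk⇔
    (λ x∈S → let c , x≡ = proj₁ (spans x) x∈S
             in tabulate c , trans x≡ (lincomb-cong k (λ l → sym (lookup∘tabulate c l)) (λ l → sym (lookup∘tabulate v l))))
    (λ (c , x≡) → proj₂ (spans x) (lookup c , trans x≡ (⊛-lincomb c v)))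

  -- Equivalently, M has a singular k × k minor.
  record Degenerate (M : Mat k n) : Set where
    constructor degenerate
    field
      columns : Vec (Fin n) k
      message : Vect F k
      columns-injective : Injective _≡_ _≡_ (lookup columns)
      message≢0 : message ≢ zeroV F
      codeword-vanishes : ∀ j → lookup (message ⊛ M) (lookup columns j) ≡ 0F

  degenerate? : (M : Mat k n) → Dec (Degenerate M)
  degenerate? {k} {n} M =
    map′ (λ (t , c , i , z , v) → degenerate t c (λ {x y} → i) z v) (λ (degenerate t c i z v) → t , c , (λ {x y} → i) , z , v)
    (∃?-via-↔ (Vec-size ↔-refl k) λ t → ∃?-via-↔ (Vect-size k) λ c →
      injective? t ×-dec ¬? (≡-dec _≟_ c (zeroV F)) ×-dec all? (λ j → lookup (c ⊛ M) (lookup t j) ≟ 0F))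
    where
    injective? : (t : Vec (Fin n) k) → Dec (Injective _≡_ _≡_ (lookup t))
    injective? t = map′ (λ h {i} {j} → h i j) (λ h i j → h)
      (all? λ i → all? λ j → (lookup t i ≟ᶠ lookup t j) →-dec (i ≟ᶠ j))

  Degenerate-⊡ : ∀ {P : Mat k k} {M : Mat k n} → LeftInvertible P → Degenerate M → Degenerate (P ⊡ M)
  Degenerate-⊡ {P = P} {M} (Q , QP≡I) (degenerate t c t-injective c≢0 vanishes) =
    degenerate t (c ⊛ Q) t-injective cQ≢0 λ j → trans (cong (λ x → lookup x (lookup t j)) same-codeword) (vanishes j)
    where
    same-codeword : c ⊛ Q ⊛ (P ⊡ M) ≡ c ⊛ M
    same-codeword = trans (⊛-assoc (c ⊛ Q) P M) (cong (_⊛ M) (⊛-left-inverse {P = P} {Q} QP≡I c))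
    cQ≢0 : c ⊛ Q ≢ zeroV F
    cQ≢0 cQ≡0 = c≢0 (trans (sym (⊛-left-inverse {P = P} {Q} QP≡I c)) (trans (cong (_⊛ P) cQ≡0) (⊛-zeroˡ P)))

  ¬Degenerate⇒Independent : k ≤ n → ∀ {M : Mat k n} → ¬ Degenerate M → Independent M
  ¬Degenerate⇒Independent {k} {n} k≤n {M} nondegenerate c cM≡0 with ≡-dec _≟_ c (zeroV F)
  ... | yes c≡0 = c≡0
  ... | no c≢0 = contradiction (degenerate t c t-injective c≢0 vanishes) nondegenerate
    where
    t : Vec (Fin n) k
    t = tabulate (λ j → inject≤ j k≤n)
    t-injective : Injective _≡_ _≡_ (lookup t)
    t-injective {i} {j} eq = inject≤-injective k≤n k≤n i j
      (trans (sym (lookup∘tabulate _ i)) (trans eq (lookup∘tabulate _ j)))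
    vanishes : ∀ j → lookup (c ⊛ M) (lookup t j) ≡ 0F
    vanishes j = trans (cong (λ x → lookup x (lookup t j)) cM≡0) (lookup-replicate (lookup t j) 0F)

  Zeros : Vect F n → Set
  Zeros {n} x = [ p ∈ Fin n ∣ lookup x p ≡ 0F ]

  Zeros-size : ∀ (x : Vect F n) → ∃ λ z → Zeros x ↔ Fin z
  Zeros-size x = refinement-size ↔-refl (λ p → lookup x p ≟ 0F)

  many-zeros⇒Degenerate : ∀ {M : Mat k n} {x z} → x ∈⟨ M ⟩ → x ≢ zeroV F → Zeros x ↔ Fin z → k ≤ z → Degenerate M
  many-zeros⇒Degenerate {k} {M = M} {x} (c , x≡cM) x≢0 Zx↔ k≤z =
    degenerate (tabulate (value ∘ pick)) c t-injective c≢0 vanishes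
    where
    pick : Fin k → Zeros x
    pick j = Inverse.from Zx↔ (inject≤ j k≤z)
    t-injective : Injective _≡_ _≡_ (lookup (tabulate (value ∘ pick)))
    t-injective {i} {j} eq = inject≤-injective k≤z k≤z i j (Injection.injective (↔⇒↣ (↔-sym Zx↔))
      (value-injective (trans (sym (lookup∘tabulate _ i)) (trans eq (lookup∘tabulate _ j)))))
    c≢0 : c ≢ zeroV F
    c≢0 c≡0 = x≢0 (trans x≡cM (trans (cong (_⊛ M) c≡0) (⊛-zeroˡ M)))
    vanishes : ∀ j → lookup (c ⊛ M) (lookup (tabulate (value ∘ pick)) j) ≡ 0F
    vanishes j = trans (cong₂ lookup (sym x≡cM) (lookup∘tabulate _ j)) (refinement-proof (λ p → lookup x p ≟ 0F) (pick j))

  disjoint-supports : ∀ {x y : Vect F n} {a b} → ¬ SupportsMeet F x y → Zeros x ↔ Fin a → Zeros y ↔ Fin b → n ≤ a + b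
  disjoint-supports {n} {x} {y} disjoint Zx↔ Zy↔ = injection⇒≤ ↔-refl (⊎-size Zx↔ Zy↔)
    (injection-by-cases (λ p → lookup x p ≟ 0F)
      (λ p xₚ≡0 → p , [ xₚ≡0 ])
      (λ p xₚ≢0 → p , [ decidable-stable (lookup y p ≟ 0F) (λ yₚ≢0 → disjoint (p , xₚ≢0 , yₚ≢0)) ])
      (λ _ _ → cong value) (λ _ _ → cong value))

  ¬Degenerate⇒intersecting : 2 * k ∸ 1 ≤ n → ∀ {S} (S-code : IsCode F n k S) →
    ¬ Degenerate (generator S-code) → IsIntersecting F n S
  ¬Degenerate⇒intersecting 2k∸1≤n S-code nondegenerate x y x∈S y∈S x≢0 y≢0
    with any? (λ p → ¬? (lookup x p ≟ 0F) ×-dec ¬? (lookup y p ≟ 0F))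
  ... | yes meet = meet
  ... | no disjoint with Zeros-size x | Zeros-size y
  ... | a , Zx↔ | b , Zy↔ with k≤a⊎k≤b 2k∸1≤n (disjoint-supports {x = x} {y} disjoint Zx↔ Zy↔)
  ... | inj₁ k≤a = contradiction
    (many-zeros⇒Degenerate {M = generator S-code} (Equivalence.to (∈⇔∈⟨generator⟩ S-code x) x∈S) x≢0 Zx↔ k≤a) nondegenerate
  ... | inj₂ k≤b = contradiction
    (many-zeros⇒Degenerate {M = generator S-code} (Equivalence.to (∈⇔∈⟨generator⟩ S-code y) y∈S) y≢0 Zy↔ k≤b) nondegenerate

  overwrite : Vec (Fin n) k → Vect F k → Vect F n → Vect F n
  overwrite [] [] row = row
  overwrite (p ∷ t) (x ∷ a) row = overwrite t a row [ p ]≔ x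

  lookup-overwrite-∉ : ∀ (t : Vec (Fin n) k) a row {q} → (∀ j → lookup t j ≢ q) → lookup (overwrite t a row) q ≡ lookup row q
  lookup-overwrite-∉ [] [] row q∉t = refl
  lookup-overwrite-∉ (p ∷ t) (x ∷ a) row q∉t =
    trans (lookup∘update′ (q∉t zero ∘ sym) (overwrite t a row) x) (lookup-overwrite-∉ t a row (q∉t ∘ suc))

  lookup-overwrite : ∀ (t : Vec (Fin n) k) a row → Injective _≡_ _≡_ (lookup t) →
    ∀ j → lookup (overwrite t a row) (lookup t j) ≡ lookup a j
  lookup-overwrite (p ∷ t) (x ∷ a) row t-injective zero = lookup∘update p (overwrite t a row) x
  lookup-overwrite (p ∷ t) (x ∷ a) row t-injective (suc j) =
    trans (lookup∘update′ (λ tⱼ≡p → 0≢1+n (t-injective (sym tⱼ≡p))) (overwrite t a row) x)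
          (lookup-overwrite t a row (suc-injective ∘ t-injective) j)

  overwrite-determines : ∀ {m} {M₁ M₂ : Mat k n} {c : Vect F k} {i} {t : Vec (Fin n) m} {a₁ a₂} → lookup c i ≢ 0F →
    (∀ j → lookup (c ⊛ M₁) (lookup t j) ≡ 0F) → (∀ j → lookup (c ⊛ M₂) (lookup t j) ≡ 0F) →
    M₁ [ i ]%= overwrite t a₁ ≡ M₂ [ i ]%= overwrite t a₂ → M₁ ≡ M₂
  overwrite-determines {M₁ = M₁} {M₂} {c} {i} {t} {a₁} {a₂} cᵢ≢0 M₁-vanishes M₂-vanishes same =
    Vec-ext λ l → Vec-ext λ p → entry l p
    where
    rowᵢ : overwrite t a₁ (lookup M₁ i) ≡ overwrite t a₂ (lookup M₂ i)
    rowᵢ = trans (sym (lookup∘updateAt i M₁)) (trans (cong (λ M → lookup M i) same) (lookup∘updateAt i M₂))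
    other-rows : ∀ l → l ≢ i → lookup M₁ l ≡ lookup M₂ l
    other-rows l l≢i =
      trans (sym (lookup∘updateAt′ l i l≢i M₁)) (trans (cong (λ M → lookup M l) same) (lookup∘updateAt′ l i l≢i M₂))
    entry : ∀ l p → lookup (lookup M₁ l) p ≡ lookup (lookup M₂ l) p
    entry l p with l ≟ᶠ i | any? (λ j → lookup t j ≟ᶠ p)
    ... | no l≢i | _ = cong (λ row → lookup row p) (other-rows l l≢i)
    ... | yes refl | no p∉t = begin
      lookup (lookup M₁ i) p                   ≡⟨ lookup-overwrite-∉ t a₁ (lookup M₁ i) (λ j tⱼ≡p → p∉t (j , tⱼ≡p)) ⟨
      lookup (overwrite t a₁ (lookup M₁ i)) p  ≡⟨ cong (λ row → lookup row p) rowᵢ ⟩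
      lookup (overwrite t a₂ (lookup M₂ i)) p  ≡⟨ lookup-overwrite-∉ t a₂ (lookup M₂ i) (λ j tⱼ≡p → p∉t (j , tⱼ≡p)) ⟩
      lookup (lookup M₂ i) p                   ∎
    ... | yes refl | yes (j , refl) =
      ∑-determines-term (lookup c) (λ l → lookup (lookup M₁ l) p) (λ l → lookup (lookup M₂ l) p) i cᵢ≢0
      (λ l l≢i → cong (λ row → lookup row p) (other-rows l l≢i))
      (trans (sym (lookup-⊛ c M₁ p)) (trans (M₁-vanishes j) (trans (sym (M₂-vanishes j)) (lookup-⊛ c M₂ p))))

  overwrite-injective : ∀ {m} {M : Mat k n} {i} {t : Vec (Fin n) m} {a₁ a₂} → Injective _≡_ _≡_ (lookup t) →
    M [ i ]%= overwrite t a₁ ≡ M [ i ]%= overwrite t a₂ → a₁ ≡ a₂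
  overwrite-injective {M = M} {i} {t} {a₁} {a₂} t-injective same = Vec-ext λ j → begin
    lookup a₁ j                                          ≡⟨ lookup-overwrite t a₁ (lookup M i) t-injective j ⟨
    lookup (overwrite t a₁ (lookup M i)) (lookup t j)    ≡⟨ cong (λ row → lookup row (lookup t j)) rowᵢ ⟩
    lookup (overwrite t a₂ (lookup M i)) (lookup t j)    ≡⟨ lookup-overwrite t a₂ (lookup M i) t-injective j ⟩
    lookup a₂ j                                          ∎
    where
    rowᵢ : overwrite t a₁ (lookup M i) ≡ overwrite t a₂ (lookup M i)
    rowᵢ = trans (sym (lookup∘updateAt i M)) (trans (cong (λ M → lookup M i) same) (lookup∘updateAt i M))

  nonzero-entry : ∀ {c : Vect F k} → c ≢ zeroV F → ∃ λ i → lookup c i ≢ 0F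
  nonzero-entry {c = c} c≢0 with any? (λ i → ¬? (lookup c i ≟ 0F))
  ... | yes entry = entry
  ... | no all-zero = contradiction (Vec-ext λ i → trans (decidable-stable (lookup c i ≟ 0F) (λ cᵢ≢0 → all-zero (i , cᵢ≢0)))
                                                         (sym (lookup-replicate i 0F))) c≢0

  Units : Set
  Units = [ x ∈ Carrier ∣ x ≢ 0F ]

  Units-size : ∃ λ u → Units ↔ Fin u
  Units-size = refinement-size enum (λ x → ¬? (x ≟ 0F))

  size≤1+units : ∀ {u} → Units ↔ Fin u → size ≤ 1 + u
  size≤1+units Units↔ = injection⇒≤ enum (⊎-size (↔-sym 1↔⊤) Units↔)
    (injection-by-cases (_≟ 0F) (λ _ _ → tt) (λ x x≢0 → x , [ x≢0 ])
      (λ x≡0 y≡0 _ → trans x≡0 (sym y≡0)) (λ _ _ → cong value))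

  Degenerates : ℕ → ℕ → Set
  Degenerates k n = [ M ∈ Mat k n ∣ Degenerate M ]

  Degenerates-size : ∀ k n → ∃ λ s → Degenerates k n ↔ Fin s
  Degenerates-size k n = refinement-size (Mat-size k n) degenerate?

  -- Decodable because the relation u c vanishes on the columns t and has a nonzero pivot entry i,
  -- which determines the overwritten entries (overwrite-determines).
  encodeWith : (M : Mat k n) → Degenerate M → Units × Vect F k → Vec (Fin n) k × (Fin k × (Vect F k × Mat k n))
  encodeWith {k} M (degenerate t c _ c≢0 _) (u , a) = t , i , value u ·ᵥ c , M [ i ]%= overwrite t a
    where
    i : Fin k
    i = proj₁ (nonzero-entry c≢0)

  encodeWith-determines-matrix : ∀ {M₁ M₂ : Mat k n} (d₁ : Degenerate M₁) (d₂ : Degenerate M₂) {x₁ x₂} →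
    encodeWith M₁ d₁ x₁ ≡ encodeWith M₂ d₂ x₂ → M₁ ≡ M₂
  encodeWith-determines-matrix {k} {n} {M₁} {M₂} (degenerate t c₁ _ c₁≢0 M₁-vanishes) (degenerate t′ c₂ _ c₂≢0 M₂-vanishes)
    {u₁ , a₁} {u₂ , a₂} eq with ,-injective eq
  ... | refl , eq′ with ,-injective eq′
  ... | i₁≡i₂ , eq″ with ,-injective eq″
  ... | u₁c₁≡u₂c₂ , same-overwrite =
    overwrite-determines {M₁ = M₁} {M₂} {value u₁ ·ᵥ c₁} {i} {t} {a₁} {a₂} pivot≢0 (scaled-vanishes {M₁} {c₁} u₁ M₁-vanishes)
    (λ j → trans (cong (λ c → lookup (c ⊛ M₂) (lookup t j)) u₁c₁≡u₂c₂) (scaled-vanishes {M₂} {c₂} u₂ M₂-vanishes j))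
    (trans same-overwrite (cong (λ i → M₂ [ i ]%= overwrite t a₂) (sym i₁≡i₂)))
    where
    i : Fin k
    i = proj₁ (nonzero-entry c₁≢0)
    pivot≢0 : lookup (value u₁ ·ᵥ c₁) i ≢ 0F
    pivot≢0 = subst (_≢ 0F) (sym (lookup-map i _ c₁))
      (*-nonzero (refinement-proof (λ x → ¬? (x ≟ 0F)) u₁) (proj₂ (nonzero-entry c₁≢0)))
    scaled-vanishes : ∀ {M : Mat k n} {c : Vect F k} (u : Units) → (∀ j → lookup (c ⊛ M) (lookup t j) ≡ 0F) →
      ∀ j → lookup (value u ·ᵥ c ⊛ M) (lookup t j) ≡ 0F
    scaled-vanishes {M} {c} u M-vanishes j =
      trans (lookup-·ᵥ-⊛ (value u) c M (lookup t j)) (trans (cong (value u *F_) (M-vanishes j)) (zeroʳ _))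

  encodeWith-injective : ∀ {M : Mat k n} (d : Degenerate M) → Injective _≡_ _≡_ (encodeWith M d)
  encodeWith-injective {k} {M = M} (degenerate t c t-injective c≢0 _) {u₁ , a₁} {u₂ , a₂} eq
    with ,-injective (,-injectiveʳ (,-injectiveʳ eq))
  ... | u₁c≡u₂c , same-overwrite =
    cong₂ _,_ (value-injective u₁≡u₂) (overwrite-injective {M = M} {i} {t} t-injective same-overwrite)
    where
    i : Fin k
    i = proj₁ (nonzero-entry c≢0)
    u₁≡u₂ : value u₁ ≡ value u₂
    u₁≡u₂ = *-cancelʳ-nonzero _ _ (proj₂ (nonzero-entry c≢0))
      (trans (sym (lookup-map i _ c)) (trans (cong (λ v → lookup v i) u₁c≡u₂c) (lookup-map i _ c)))

  degeneracy : (M : Degenerates k n) → Degenerate (value M)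
  degeneracy = refinement-proof degenerate?

  encode : Degenerates k n × (Units × Vect F k) → Vec (Fin n) k × (Fin k × (Vect F k × Mat k n))
  encode (M , x) = encodeWith (value M) (degeneracy M) x

  encode-injective : Injective _≡_ _≡_ (encode {k} {n})
  encode-injective {x = M₁ , x₁} {M₂ , x₂} eq
    with value-injective {v = M₁} {M₂} (encodeWith-determines-matrix (degeneracy M₁) (degeneracy M₂) {x₁} {x₂} eq)
  ... | refl = cong (M₁ ,_) (encodeWith-injective (degeneracy M₁) {x₁} {x₂} eq)

  degenerate-count : ∀ {s u} → Degenerates k n ↔ Fin s → Units ↔ Fin u →
    s * (u * size ^ k) ≤ (n ^ k * k) * (size ^ k * (size ^ n) ^ k)
  degenerate-count {k} {n} Degenerates↔ Units↔ = ≤-trans (injection⇒≤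
    (×-size Degenerates↔ (×-size Units↔ (Vect-size k)))
    (×-size (Vec-size (↔-refl {A = Fin n}) k) (×-size (↔-refl {A = Fin k}) (×-size (Vect-size k) (Mat-size k n))))
    (mk↣ encode-injective)) (≤-reflexive (sym (ℕ.*-assoc (n ^ k) k _)))

  module CodeList {k n N} (codes : IsCount F n (IsCode F n k) N) where

    code : Fin N → SubsetV F n
    code = proj₁ codes

    code-isCode : ∀ i → IsCode F n k (code i)
    code-isCode = proj₁ (proj₂ codes)

    G : Fin N → Mat k n
    G i = generator (code-isCode i)

    index-unique : ∀ {i j} → SameRowSpace (G i) (G j) → i ≡ j
    index-unique {i} {j} same = proj₁ (proj₂ (proj₂ codes)) i j λ x →
      ⇔→≡ (⇔-sym (∈⇔∈⟨generator⟩ (code-isCode j) x) ⇔-∘ (same x ⇔-∘ ∈⇔∈⟨generator⟩ (code-isCode i) x))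

    index-of : ∀ {M : Mat k n} → Independent M → ∃ λ i → SameRowSpace M (G i)
    index-of {M} independent with proj₂ (proj₂ (proj₂ codes)) (rowSpace M) (rowSpace-isCode {M = M} independent)
    ... | i , same-set = i , λ x → ∈⇔∈⟨generator⟩ (code-isCode i) x
      ⇔-∘ (mk⇔ (trans (sym (same-set x))) (trans (same-set x)) ⇔-∘ ⇔-sym (∈rowSpace⇔∈⟨⟩ M x))

    _⊡G_ : GL k → Fin N → Mat k n
    P ⊡G i = value P ⊡ G i

    factor-through-code : ∀ {M : Mat k n} → Independent M → ∃ λ ((P , i) : GL k × Fin N) → M ≡ P ⊡G i
    factor-through-code {M} independent =
      let i , same = index-of {M} independent
          P , P-invertible , M≡PB = SameRowSpace⇒factor {M = M} {G i} (generator-independent (code-isCode i)) same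
      in ((P , [ P-invertible ]) , i) , M≡PB

    ⊡G-injective : Injective _≡_ _≡_ (λ ((P , i) : GL k × Fin N) → P ⊡G i)
    ⊡G-injective {P₁ , i₁} {P₂ , i₂} eq with index-unique same
      where
      same : SameRowSpace (G i₁) (G i₂)
      same x = ⊡-SameRowSpace {P = value P₂} (G i₂) (GL-leftInvertible P₂) x
        ⇔-∘ (mk⇔ (subst (x ∈⟨_⟩) eq) (subst (x ∈⟨_⟩) (sym eq))
        ⇔-∘ ⇔-sym (⊡-SameRowSpace {P = value P₁} (G i₁) (GL-leftInvertible P₁) x))
    ... | refl = cong (_, i₁) (value-injective (⊡-cancelʳ {M = G i₁} (generator-independent (code-isCode i₁)) eq))

    module _ {s g} (Degenerates↔ : Degenerates k n ↔ Fin s) (GL↔ : GL k ↔ Fin g) where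

      matrix-count : k ≤ n → (size ^ n) ^ k ≤ s + g * N
      matrix-count k≤n =
        injection⇒≤ (Mat-size k n) (⊎-size Degenerates↔ (×-size GL↔ (↔-refl {A = Fin N})))
          (injection-by-cases degenerate? (λ M d → M , [ d ]) (λ M nd → proj₁ (factorisation {M} nd))
            (λ _ _ → cong value) factorisation-injective)
        where
        factorisation : ∀ {M : Mat k n} → ¬ Degenerate M → ∃ λ ((P , i) : GL k × Fin N) → M ≡ P ⊡G i
        factorisation {M} nondegenerate = factor-through-code {M} (¬Degenerate⇒Independent k≤n nondegenerate)
        factorisation-injective : ∀ {M₁ M₂ : Mat k n} (nd₁ : ¬ Degenerate M₁) (nd₂ : ¬ Degenerate M₂) →
          proj₁ (factorisation nd₁) ≡ proj₁ (factorisation nd₂) → M₁ ≡ M₂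
        factorisation-injective {M₁} {M₂} nd₁ nd₂ same-factors = trans (proj₂ (factorisation {M₁} nd₁))
          (trans (cong (λ (P , i) → P ⊡G i) same-factors) (sym (proj₂ (factorisation {M₂} nd₂))))

      code-count : ∀ {M} → 2 * k ∸ 1 ≤ n → IsCount F n (IsIntersectingCode F n k) M → g * N ≤ s + g * M
      code-count {M} 2k∸1≤n (K , _ , _ , K-complete) =
        injection⇒≤ (×-size GL↔ (↔-refl {A = Fin N})) (⊎-size Degenerates↔ (×-size GL↔ (↔-refl {A = Fin M})))
          (injection-by-cases (λ (_ , i) → degenerate? (G i))
            (λ (P , i) d → P ⊡G i , [ Degenerate-⊡ (GL-leftInvertible P) d ])
            (λ (P , i) nd → P , proj₁ (intersecting-index i nd))
            (λ _ _ → ⊡G-injective ∘ cong value)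
            (λ nd₁ nd₂ eq → cong₂ _,_ (,-injectiveˡ eq) (intersecting-index-injective nd₁ nd₂ (,-injectiveʳ eq))))
        where
        intersecting-index : ∀ i → ¬ Degenerate (G i) → ∃ λ j → ExtEq F (code i) (K j)
        intersecting-index i nd = K-complete (code i) (code-isCode i , ¬Degenerate⇒intersecting 2k∸1≤n (code-isCode i) nd)
        intersecting-index-injective : ∀ {i₁ i₂} nd₁ nd₂ →
          proj₁ (intersecting-index i₁ nd₁) ≡ proj₁ (intersecting-index i₂ nd₂) → i₁ ≡ i₂
        intersecting-index-injective {i₁} {i₂} nd₁ nd₂ same-index = proj₁ (proj₂ (proj₂ codes)) i₁ i₂ λ x →
          trans (proj₂ (intersecting-index i₁ nd₁) x)
            (trans (cong (λ j → K j x) same-index) (sym (proj₂ (intersecting-index i₂ nd₂) x)))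

  disjoint-blocks : ∀ {a b} {x y : Vect F (a + b)} → (∀ i → lookup x (i ↑ˡ b) ≡ 0F) → (∀ j → lookup y (a ↑ʳ j) ≡ 0F) →
    ¬ SupportsMeet F x y
  disjoint-blocks {a} {b} {x} {y} x-vanishes y-vanishes (p , xₚ≢0 , yₚ≢0) with splitAt a p in eq
  ... | inj₁ i = xₚ≢0 (subst (λ q → lookup x q ≡ 0F) (splitAt⁻¹-↑ˡ eq) (x-vanishes i))
  ... | inj₂ j = yₚ≢0 (subst (λ q → lookup y q ≡ 0F) (splitAt⁻¹-↑ʳ eq) (y-vanishes j))

  no-intersecting-code : ∀ {n k} → n < 2 * k ∸ 1 → ∀ {S} → IsCode F n k S → ¬ IsIntersecting F n S
  no-intersecting-code {n} {k} n<2k∸1 {S} S-code intersecting with split-below {k = k} n<2k∸1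
  ... | a , b , refl , a<k , b<k =
    let c₁ , c₁≢0 , x-vanishes = vanishing-combination G (_↑ˡ b) a<k
        c₂ , c₂≢0 , y-vanishes = vanishing-combination G (a ↑ʳ_) b<k
    in disjoint-blocks {x = c₁ ⊛ G} {c₂ ⊛ G} x-vanishes y-vanishes
         (intersecting (c₁ ⊛ G) (c₂ ⊛ G) (codeword c₁) (codeword c₂) (nonzero c₁≢0) (nonzero c₂≢0))
    where
    G : Mat k n
    G = generator S-code
    codeword : ∀ c → S (c ⊛ G) ≡ true
    codeword c = Equivalence.from (∈⇔∈⟨generator⟩ S-code (c ⊛ G)) (c , refl)
    nonzero : ∀ {c} → c ≢ zeroV F → c ⊛ G ≢ zeroV F
    nonzero c≢0 cG≡0 = c≢0 (generator-independent S-code _ cG≡0)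

  no-intersecting-codes : ∀ {n k M} → n < 2 * k ∸ 1 → IsCount F n (IsIntersectingCode F n k) M → M ≡ 0
  no-intersecting-codes {M = zero} _ _ = refl
  no-intersecting-codes {M = suc _} n<2k∸1 (_ , intersecting-codes , _) =
    contradiction (proj₂ (intersecting-codes Fin.zero)) (no-intersecting-code n<2k∸1 (proj₁ (intersecting-codes Fin.zero)))

  dense-bound : ∀ {k n} m → 1 < k → 1 ≤ n → 2 * k ∸ 1 ≤ n → suc ((2 + m) * (n ^ k * k)) ≤ size →
    ∀ {N M} → IsCount F n (IsCode F n k) N → IsCount F n (IsIntersectingCode F n k) M → suc m * (N ∸ M) ≤ N
  dense-bound {k} {n} m 1<k 1≤n 2k∸1≤n threshold≤size {N} {M} codes intersecting-codes =
    few-nonintersecting m {s} {(size ^ n) ^ k} {N} {M} {g} {{>-nonZero (1≤GL-size GL↔)}}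
      (few-degenerate m {n ^ k * k} {size ^ k} {s} {u} {(size ^ n) ^ k}
        {{A≢0}} {{m^n≢0 size k {{>-nonZero (<⇒≤ 2≤size)}}}}
        (≤-pred (≤-trans threshold≤size (size≤1+units Units↔))) (degenerate-count Degenerates↔ Units↔))
      (matrix-count Degenerates↔ GL↔ (≤-trans (k≤2k∸1 (<⇒≤ 1<k)) 2k∸1≤n))
      (code-count Degenerates↔ GL↔ 2k∸1≤n intersecting-codes)
    where
    open CodeList codes
    s u g : ℕ
    s = proj₁ (Degenerates-size k n)
    u = proj₁ Units-size
    g = proj₁ (GL-size k)
    Degenerates↔ : Degenerates k n ↔ Fin s
    Degenerates↔ = proj₂ (Degenerates-size k n)
    Units↔ : Units ↔ Fin u
    Units↔ = proj₂ Units-size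
    GL↔ : GL k ↔ Fin g
    GL↔ = proj₂ (GL-size k)
    A≢0 : NonZero (n ^ k * k)
    A≢0 = m*n≢0 (n ^ k) k {{m^n≢0 n k {{>-nonZero 1≤n}}}} {{>-nonZero (<⇒≤ 1<k)}}

-- Once q − 1 ≥ (m + 2) · k · n^k, at most a 1/(m + 2) fraction of the k × n matrices is degenerate.
intersecting-codes-dense : ∀ k n → 1 < k → 1 ≤ n → 2 * k ∸ 1 ≤ n → DenseIntersecting n k
intersecting-codes-dense k n 1<k 1≤n 2k∸1≤n m =
  suc ((2 + m) * (n ^ k * k)) , λ F threshold≤size _ _ codes intersecting-codes →
    dense-bound F m 1<k 1≤n 2k∸1≤n threshold≤size codes intersecting-codes

intersecting-codes-sparse : ∀ k n → n < 2 * k ∸ 1 → SparseIntersecting n k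
intersecting-codes-sparse k n n<2k∸1 m = 0 , λ F _ N _ _ intersecting-codes →
  subst (λ M → suc m * M ≤ N) (sym (no-intersecting-codes F n<2k∸1 intersecting-codes))
    (subst (_≤ N) (sym (*-zeroʳ (suc m))) z≤n)

theorem3p6 : (k n : ℕ) → 1 < k → 1 ≤ n →
    ((2 * k ∸ 1 ≤ n → DenseIntersecting n k) × (n < 2 * k ∸ 1 → SparseIntersecting n k))
theorem3p6 k n 1<k 1≤n = intersecting-codes-dense k n 1<k 1≤n , intersecting-codes-sparse k n
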